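{- For each integer $k\ge1$, the class of $k$-letter graphs is a proper subclass of the class of $k$-thin graphs.
   Context: A graph $G=(\{1,\dots,n\},E)$ is a $k$-letter graph if there exist a word $w\in\{1,\dots,k\}^n$ and a set $\mathcal{D}\subseteq\{1,\dots,k\}^2$ such that for all $1\le i<j\le n$: $\{i,j\}\in E$ iff $w[i]w[j]\in\mathcal{D}$ (graphs isomorphic to such graphs are also $k$-letter graphs). A graph $G=(V,E)$ is $k$-thin if its vertices admit a linear ordering $v_1<\dots<v_n$ and a partition $V=V^1\uplus\dots\uplus V^k$ such that for all $a<b<c$ with $v_a,v_b$ in the same part and $\{v_a,v_c\}\in E$, also $\{v_b,v_c\}\in E$. -}

module Defs where

open import Data.Nat using (ℕ; suc; _≤_)
open import Data.Fin using (Fin; _<_)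
open import Data.Bool using (Bool; true; false)
open import Data.Product using (Σ; ∃; _×_; _,_)
open import Relation.Binary.PropositionalEquality using (_≡_)
open import Function.Bundles using (_↔_; Inverse)
open import Relation.Nullary using (¬_)

record Graph : Set where
  field
    n      : ℕ
    adj    : Fin n → Fin n → Bool
    sym    : ∀ u v → adj u v ≡ adj v u
    irrefl : ∀ v → adj v v ≡ false

open Graph public

-- G is a k-letter graph: G is isomorphic (via σ, sending position i to
-- vertex σ i of G) to the letter graph given by a word w ∈ {1..k}^n and a
-- set D ⊆ {1..k}² (as a Boolean-valued relation):
-- for positions i < j, {i,j} is an edge iff w[i]w[j] ∈ D.
IsLetterGraph : ℕ → Graph → Set
IsLetterGraph k G =
  Σ (Fin (n G) ↔ Fin (n G)) λ σ →
  Σ (Fin (n G) → Fin k) λ w →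
  Σ (Fin k → Fin k → Bool) λ D →
    ∀ (i j : Fin (n G)) → i < j →
      adj G (Inverse.to σ i) (Inverse.to σ j) ≡ D (w i) (w j)

-- G is k-thin: there is a linear ordering v_1 < ... < v_n of the vertices
-- (v_a = π a) and a partition of the vertices into k (possibly empty) parts
-- (vertex v lies in part 'part v') such that for all a < b < c, if v_a and v_b
-- are in the same part and v_a v_c is an edge, then v_b v_c is an edge.
IsThin : ℕ → Graph → Set
IsThin k G =
  Σ (Fin (n G) ↔ Fin (n G)) λ π →
  Σ (Fin (n G) → Fin k) λ part →
    ∀ (a b c : Fin (n G)) → a < b → b < c →
      part (Inverse.to π a) ≡ part (Inverse.to π b) →
      adj G (Inverse.to π a) (Inverse.to π c) ≡ true →
      adj G (Inverse.to π b) (Inverse.to π c) ≡ true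

{-# OPTIONS --safe #-}
module Submission where

-- Ordering a letter graph by its word and partitioning it by letters makes it thin: if a and b
-- carry the same letter and a < b < c, then b sees c exactly when a does.  Conversely, in a
-- k-letter graph the later endpoints of an induced matching carry pairwise distinct letters, so
-- the perfect matching with k + 1 edges is not a k-letter graph; yet it is 1-thin, since in the
-- natural order every clique of a disjoint union of cliques is an interval.

open import Defs hiding (sym)
open import Data.Bool using (Bool; true; false; not; if_then_else_)
open import Data.Fin using (Fin; toℕ; _<_; _≤_; quotient; combine)
open import Data.Fin.Patterns using (0F; 1F)
open import Data.Fin.Properties
  using (_≟_; <-cmp; <⇒≢; injective⇒≤; remQuot-combine; combine-remQuot; combine-monoˡ-<; combine-injectiveʳ)
open import Data.Nat using (ℕ; zero; suc; _+_; _*_; _≥_) renaming (_≤_ to _≤ℕ_)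
open import Data.Nat.Properties using (<-trans; <-≤-trans; <-irrefl; <-asym; ≮⇒≥; 1+n≰n; module ≤-Reasoning)
open import Data.Product using (Σ; _×_; _,_; proj₁; proj₂)
open import Function using (_∘_; Injective; Injection; Inverse; mk⇔)
open import Function.Properties.Inverse using (↔-refl; ↔-sym; ↔⇒↣)
open import Level using (0ℓ)
open import Relation.Binary using (Rel; Decidable; Symmetric; Irreflexive; tri<; tri≈; tri>)
open import Relation.Binary.PropositionalEquality
  using (_≡_; _≢_; refl; sym; trans; cong; cong₂; subst; subst₂; module ≡-Reasoning)
open import Relation.Nullary using (¬_; Dec; yes; no; does; contradiction; ¬?; _×-dec_)
open import Relation.Nullary.Decidable using (dec-true; dec-false; does-⇔)

letterGraph⇒thin : ∀ {k} (G : Graph) → IsLetterGraph k G → IsThin k G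
letterGraph⇒thin G (σ , w , D , spells) = σ , w ∘ from , thin
  where
  open Inverse σ
  open ≡-Reasoning

  thin : ∀ a b c → a < b → b < c → w (from (to a)) ≡ w (from (to b)) →
         adj G (to a) (to c) ≡ true → adj G (to b) (to c) ≡ true
  thin a b c a<b b<c same-part ac = begin
    adj G (to b) (to c)  ≡⟨ spells b c b<c ⟩
    D (w b) (w c)        ≡⟨ cong (λ x → D x (w c)) (sym same-letter) ⟩
    D (w a) (w c)        ≡⟨ spells a c (<-trans a<b b<c) ⟨
    adj G (to a) (to c)  ≡⟨ ac ⟩
    true                 ∎
    where
    same-letter : w a ≡ w b
    same-letter = subst₂ (λ x y → w x ≡ w y) (strictlyInverseʳ a) (strictlyInverseʳ b) same-part

record InducedMatching (m : ℕ) (G : Graph) : Set where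
  field
    end      : Fin m → Bool → Fin (n G)
    joined   : ∀ t → adj G (end t false) (end t true) ≡ true
    separate : ∀ {s t} → s ≢ t → ∀ i j → adj G (end s i) (end t j) ≡ false

  joined′ : ∀ t i → adj G (end t i) (end t (not i)) ≡ true
  joined′ t false = joined t
  joined′ t true  = trans (Graph.sym G _ _) (joined t)

  ends-distinct : ∀ t → end t false ≢ end t true
  ends-distinct t e = contradiction (trans (sym loop) (irrefl G (end t true))) λ ()
    where
    loop : adj G (end t true) (end t true) ≡ true
    loop = subst (λ v → adj G v (end t true) ≡ true) e (joined t)

-- If the later endpoints of two edges shared a letter, the earlier endpoint of each edge
-- would be joined to the other edge too, so each edge would end before the other begins.
module _ {N k m : ℕ} (w : Fin N → Fin k) (D : Fin k → Fin k → Bool)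
         (lo hi : Fin m → Fin N) (lo<hi : ∀ t → lo t < hi t)
         (edge : ∀ t → D (w (lo t)) (w (hi t)) ≡ true)
         (non-edge : ∀ {s t} → s ≢ t → lo s < hi t → D (w (lo s)) (w (hi t)) ≡ false)
         where

  private
    same-letter⇒apart : ∀ {s t} → s ≢ t → w (hi s) ≡ w (hi t) → hi t ≤ lo s
    same-letter⇒apart {s} {t} s≢t same = ≮⇒≥ λ los<hit → contradiction (begin
      false                    ≡⟨ non-edge s≢t los<hit ⟨
      D (w (lo s)) (w (hi t))  ≡⟨ cong (D (w (lo s))) same ⟨
      D (w (lo s)) (w (hi s))  ≡⟨ edge s ⟩
      true                     ∎) λ ()
      where open ≡-Reasoning

  lastLetter-injective : Injective _≡_ _≡_ (w ∘ hi)
  lastLetter-injective {s} {t} same with s ≟ t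
  ... | yes s≡t = s≡t
  ... | no s≢t  = contradiction cycle (<-irrefl refl)
    where
    cycle : lo s < lo s
    cycle = begin-strict
      toℕ (lo s)  <⟨ lo<hi s ⟩
      toℕ (hi s)  ≤⟨ same-letter⇒apart (s≢t ∘ sym) (sym same) ⟩
      toℕ (lo t)  <⟨ lo<hi t ⟩
      toℕ (hi t)  ≤⟨ same-letter⇒apart s≢t same ⟩
      toℕ (lo s)  ∎
      where open ≤-Reasoning

orient : ∀ {N} (f : Bool → Fin N) → f false ≢ f true → Σ Bool λ i → f i < f (not i)
orient f f₀≢f₁ with <-cmp (f false) (f true)
... | tri< f₀<f₁ _ _ = false , f₀<f₁
... | tri≈ _ f₀≡f₁ _ = contradiction f₀≡f₁ f₀≢f₁
... | tri> _ _ f₁<f₀ = true , f₁<f₀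

letterGraph⇒inducedMatching≤ : ∀ {k m G} → IsLetterGraph k G → InducedMatching m G → m ≤ℕ k
letterGraph⇒inducedMatching≤ {m = m} {G} (σ , w , D , spells) M =
  injective⇒≤ (lastLetter-injective w D lo hi lo<hi edge non-edge)
  where
  open Inverse σ
  open InducedMatching M

  from-injective : Injective _≡_ _≡_ from
  from-injective = Injection.injective (↔⇒↣ (↔-sym σ))

  position : Fin m → Bool → Fin (n G)
  position t i = from (end t i)

  oriented : ∀ t → Σ Bool λ i → position t i < position t (not i)
  oriented t = orient (position t) (ends-distinct t ∘ from-injective)

  first : Fin m → Bool
  first t = proj₁ (oriented t)

  lo hi : Fin m → Fin (n G)
  lo t = position t (first t)
  hi t = position t (not (first t))

  lo<hi : ∀ t → lo t < hi t
  lo<hi t = proj₂ (oriented t)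

  spells-ends : ∀ {s t i j} → position s i < position t j →
                adj G (end s i) (end t j) ≡ D (w (position s i)) (w (position t j))
  spells-ends p = trans (sym (cong₂ (adj G) (strictlyInverseˡ _) (strictlyInverseˡ _))) (spells _ _ p)

  edge : ∀ t → D (w (lo t)) (w (hi t)) ≡ true
  edge t = trans (sym (spells-ends (lo<hi t))) (joined′ t (first t))

  non-edge : ∀ {s t} → s ≢ t → lo s < hi t → D (w (lo s)) (w (hi t)) ≡ false
  non-edge s≢t p = trans (sym (spells-ends p)) (separate s≢t _ _)

relationGraph : ∀ {N} {R : Rel (Fin N) 0ℓ} → Decidable R → Symmetric R → Irreflexive _≡_ R → Graph
relationGraph {N} {R} R? R-sym R-irrefl = record
  { n      = N
  ; adj    = λ u v → does (R? u v)
  ; sym    = λ u v → does-⇔ (mk⇔ R-sym R-sym) (R? u v) (R? v u)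
  ; irrefl = λ v → dec-false (R? v v) (R-irrefl refl)
  }

does-true⇒ : ∀ {A : Set} (a? : Dec A) → does a? ≡ true → A
does-true⇒ (yes a) _ = a

-- m disjoint copies of the complete graph K_d; vertex combine i j is vertex j of copy i.
module DisjointCliques (m d : ℕ) where

  clique : Fin (m * d) → Fin m
  clique = quotient {m} d

  Adjacent : Rel (Fin (m * d)) 0ℓ
  Adjacent u v = clique u ≡ clique v × u ≢ v

  adjacent? : Decidable Adjacent
  adjacent? u v = (clique u ≟ clique v) ×-dec ¬? (u ≟ v)

  graph : Graph
  graph = relationGraph adjacent? (λ (same , u≢v) → sym same , u≢v ∘ sym) (λ { refl (_ , u≢u) → u≢u refl })

  clique-<⇒< : ∀ {u v} → clique u < clique v → u < v
  clique-<⇒< {u} {v} = subst₂ _<_ (combine-remQuot {m} d u) (combine-remQuot {m} d v) ∘ combine-monoˡ-< _ _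

  clique-between : ∀ {a b c} → a < b → b < c → clique a ≡ clique c → clique b ≡ clique c
  clique-between {a} {b} {c} a<b b<c same with <-cmp (clique b) (clique c)
  ... | tri< qb<qc _ _ = contradiction (clique-<⇒< (subst (clique b <_) (sym same) qb<qc)) (<-asym a<b)
  ... | tri≈ _ qb≡qc _ = qb≡qc
  ... | tri> _ _ qc<qb = contradiction (clique-<⇒< qc<qb) (<-asym b<c)

  thin : ∀ k → IsThin (suc k) graph
  thin k = ↔-refl , (λ _ → 0F) , λ a b c a<b b<c _ ac →
    let (same , _) = does-true⇒ (adjacent? a c) ac in
    dec-true (adjacent? b c) (clique-between a<b b<c same , <⇒≢ b<c)

  clique-combine : ∀ i j → clique (combine i j) ≡ i
  clique-combine i j = cong proj₁ (remQuot-combine i j)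

cliques-inducedMatching : ∀ m d → InducedMatching m (DisjointCliques.graph m (2 + d))
cliques-inducedMatching m d = record
  { end      = end
  ; joined   = λ t → dec-true (adjacent? _ _) (trans (clique-combine t 0F) (sym (clique-combine t 1F))
                                            , λ e → contradiction (combine-injectiveʳ t 0F t 1F e) λ ())
  ; separate = λ s≢t _ _ → dec-false (adjacent? _ _) λ (same , _) →
                 s≢t (subst₂ _≡_ (clique-combine _ _) (clique-combine _ _) same)
  }
  where
  open DisjointCliques m (2 + d)

  end : Fin m → Bool → Fin (m * (2 + d))
  end t i = combine t (if i then 1F else 0F)

corollary12 : (k : ℕ) → k ≥ 1 →
    ((G : Graph) → IsLetterGraph k G → IsThin k G) ×
    Σ Graph (λ G → IsThin k G × ¬ IsLetterGraph k G)
corollary12 zero ()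
corollary12 (suc k) _ =
    letterGraph⇒thin
  , graph (suc (suc k)) 2
  , thin (suc (suc k)) 2 k
  , λ letter → 1+n≰n (letterGraph⇒inducedMatching≤ letter (cliques-inducedMatching (suc (suc k)) 0))
  where open DisjointCliques using (graph; thin)
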